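{- Let $R$ be a Dedekind domain, let $P=(p)$ be a prime principal ideal of $R$, let $J$ be an ideal of $R$ with $J\not\subseteq P$, let $\alpha$ be a positive integer, and let $I=P^{\alpha}J$, where $I$ is nonzero and $R/I$ is finite. If $\alpha>1$ or if $p-1\notin J$ and $p+1\notin J$, then $G_{R/I}$ has a cycle of length $4$.
   Context: $G_{R/I}$ is the unitary Cayley graph of $R/I$: vertex set $R/I$, with $a+I$, $b+I$ adjacent iff $a-b+I$ is a unit of $R/I$. -}

module Defs where

import Level
open import Level using (Level; _⊔_; Lift)
open import Algebra.Bundles using (CommutativeRing)
open import Data.Nat using (ℕ; zero; suc; _∸_)
open import Data.Fin using (Fin; toℕ)
import Data.Fin as F
open import Data.Product using (Σ; ∃; _×_; _,_)
open import Data.Sum using (_⊎_)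
open import Data.Unit using (⊤)
open import Relation.Nullary using (¬_)

module _ {c ℓ : Level} (R : CommutativeRing c ℓ) where
  open CommutativeRing R

  Sub : Set _
  Sub = Carrier → Set (c ⊔ ℓ)

  _⊆_ : Sub → Sub → Set (c ⊔ ℓ)
  A ⊆ B = ∀ x → A x → B x

  pow : Carrier → ℕ → Carrier
  pow x zero = 1#
  pow x (suc n) = x * pow x n

  Σᶠ : (n : ℕ) → (Fin n → Carrier) → Carrier
  Σᶠ zero f = 0#
  Σᶠ (suc n) f = f F.zero + Σᶠ n (λ i → f (F.suc i))

  record IsIdeal (I : Sub) : Set (c ⊔ ℓ) where
    field
      resp : ∀ {x y} → x ≈ y → I x → I y
      zero∈ : I 0#
      +-closed : ∀ {x y} → I x → I y → I (x + y)
      *-closed : ∀ r {x} → I x → I (r * x)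

  ⟨_⟩ : Carrier → Sub
  ⟨ p ⟩ x = Σ Carrier λ r → x ≈ r * p

  Generated : (n : ℕ) → (Fin n → Carrier) → Sub
  Generated n g x = Σ (Fin n → Carrier) λ a → x ≈ Σᶠ n (λ i → a i * g i)

  _·_ : Sub → Sub → Sub
  (A · B) x = Σ ℕ λ n → Σ (Fin n → Carrier) λ a → Σ (Fin n → Carrier) λ b →
    ((∀ i → A (a i)) × (∀ i → B (b i))) × (x ≈ Σᶠ n (λ i → a i * b i))

  whole : Sub
  whole _ = Lift (c ⊔ ℓ) ⊤

  _^ᴵ_ : Sub → ℕ → Sub
  A ^ᴵ zero = whole
  A ^ᴵ suc n = A · (A ^ᴵ n)

  IsNonzero : Sub → Set (c ⊔ ℓ)
  IsNonzero A = Σ Carrier λ x → A x × ¬ (x ≈ 0#)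

  record IsPrimeIdeal (P : Sub) : Set (c ⊔ ℓ) where
    field
      isIdeal : IsIdeal P
      proper : ¬ P 1#
      prime : ∀ a b → P (a * b) → P a ⊎ P b

  record IsMaximalIdeal (M : Sub) : Set (Level.suc (c ⊔ ℓ)) where
    field
      isIdeal : IsIdeal M
      proper : ¬ M 1#
      maximal : ∀ K → IsIdeal K → M ⊆ K → K ⊆ M ⊎ K 1#

  record IsDedekindDomain : Set (Level.suc (c ⊔ ℓ)) where
    field
      1≉0 : ¬ (1# ≈ 0#)
      noZeroDivisors : ∀ a b → a * b ≈ 0# → a ≈ 0# ⊎ b ≈ 0#
      noetherian : ∀ I → IsIdeal I →
        Σ ℕ λ n → Σ (Fin n → Carrier) λ g → I ⊆ Generated n g × Generated n g ⊆ I
      -- integrally closed: if a/b (b ≠ 0) is a root of the monic polynomial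
      -- x^n + c_{n-1} x^{n-1} + … + c_0, i.e. a^n + Σ c_i a^i b^(n-i) = 0,
      -- then a/b ∈ R, i.e. b divides a
      integrallyClosed : ∀ a b → ¬ (b ≈ 0#) → (n : ℕ) → (cs : Fin n → Carrier) →
        pow a n + Σᶠ n (λ i → cs i * (pow a (toℕ i) * pow b (n ∸ toℕ i))) ≈ 0# →
        Σ Carrier λ r → a ≈ b * r
      dimension≤1 : ∀ P → IsPrimeIdeal P → IsNonzero P → IsMaximalIdeal P

  _≡_mod_ : Carrier → Carrier → Sub → Set (c ⊔ ℓ)
  x ≡ y mod I = I (x - y)

  FiniteQuotient : Sub → Set (c ⊔ ℓ)
  FiniteQuotient I = Σ ℕ λ n → Σ (Fin n → Carrier) λ f → ∀ x → Σ (Fin n) λ i → x ≡ f i mod I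

  IsUnitMod : Sub → Carrier → Set (c ⊔ ℓ)
  IsUnitMod I x = Σ Carrier λ u → (x * u) ≡ 1# mod I

  -- adjacency in the unitary Cayley graph G_{R/I}
  Adj : Sub → Carrier → Carrier → Set (c ⊔ ℓ)
  Adj I x y = IsUnitMod I (x - y)

  Distinct : Sub → Carrier → Carrier → Set (c ⊔ ℓ)
  Distinct I x y = ¬ (x ≡ y mod I)

  Has4Cycle : Sub → Set (c ⊔ ℓ)
  Has4Cycle I = Σ Carrier λ a → Σ Carrier λ b → Σ Carrier λ c' → Σ Carrier λ d →
    (Distinct I a b × Distinct I a c' × Distinct I a d ×
     Distinct I b c' × Distinct I b d × Distinct I c' d) ×
    (Adj I a b × Adj I b c' × Adj I c' d × Adj I d a)

-- Since (p) is maximal and J ⊄ (p), some r gives j := 1 - r p ∈ J.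
-- For α = 1, modulo (p) and modulo J the vertices 0, 1, r p - p, j - p reduce to (0,0), (1,1),
-- (0,1-p), (1,-p).  Consecutive differences are units on both sides (p is a unit mod J since
-- r p ≡ 1), hence units mod (p)J by the Chinese remainder theorem, while p ± 1 ∉ J keeps the
-- vertices apart.  For α ≥ 2 put t = p^(α-1) j: then t² ∈ I, so 1 + t and 1 - t are mutually
-- inverse and 0, 1, t, 1 + t is a 4-cycle; t ∉ I because j ∉ (p) and R is a domain.
-- Only maximality of (p) and the absence of zero divisors are used; finiteness of R/I is not.
module Submission where

open import Defs
open import Level using (Level; lift)
open import Algebra.Bundles using (CommutativeRing)
open import Data.Nat as ℕ using (ℕ; zero; suc; _<_; s≤s)
import Data.Nat.Properties as ℕ
open import Data.Integer as ℤ using (ℤ; +_; -[1+_]; _⊖_; _◃_; sign; ∣_∣)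
import Data.Integer.Properties as ℤ
open import Data.Sign as Sign using (Sign)
open import Data.Fin using (Fin) renaming (zero to fzero; suc to fsuc)
open import Data.Maybe using (Maybe; just; nothing)
open import Data.Product using (Σ; _×_; _,_)
open import Data.Sum using (_⊎_; inj₁; inj₂; fromInj₂)
open import Data.Empty using (⊥-elim)
open import Relation.Nullary using (¬_; yes; no)
import Relation.Binary.PropositionalEquality as ≡
import Algebra.Properties.Ring as RingProperties
import Algebra.Properties.Group as GroupProperties
import Algebra.Properties.CommutativeSemigroup as CommutativeSemigroupProperties
import Algebra.Properties.Semiring.Mult.TCOptimised as Multiplication
import Algebra.Solver.Ring.AlmostCommutativeRing as ACR
import Relation.Binary.Reasoning.Setoid as SetoidReasoning

-- The ring solver needs a coefficient ring with decidable equality mapping into R; ℤ always does.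
module IntegerCoefficientSolver {c ℓ : Level} (R : CommutativeRing c ℓ) where
  open CommutativeRing R
  open RingProperties ring using (-0#≈0#; -‿involutive; -‿distribˡ-*; -‿distribʳ-*; -‿+-comm)
  open CommutativeSemigroupProperties +-commutativeSemigroup using (interchange)
  open Multiplication semiring using (1+×; ×-homo-+; ×1-homo-*) renaming (_×_ to _×ᵣ_)
  open SetoidReasoning setoid

  signed : Sign → Carrier → Carrier
  signed Sign.+ x = x
  signed Sign.- x = - x

  signed-cong : ∀ s {x y} → x ≈ y → signed s x ≈ signed s y
  signed-cong Sign.+ x≈y = x≈y
  signed-cong Sign.- x≈y = -‿cong x≈y

  signed-* : ∀ s t x y → signed (s Sign.* t) (x * y) ≈ signed s x * signed t y
  signed-* Sign.+ Sign.+ x y = refl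
  signed-* Sign.+ Sign.- x y = -‿distribʳ-* x y
  signed-* Sign.- Sign.+ x y = -‿distribˡ-* x y
  signed-* Sign.- Sign.- x y = begin
    x * y         ≈⟨ -‿involutive (x * y) ⟨
    - - (x * y)   ≈⟨ -‿cong (-‿distribˡ-* x y) ⟩
    - (- x * y)   ≈⟨ -‿distribʳ-* (- x) y ⟩
    - x * - y     ∎

  -- With the optimised _×ᵣ_, fromℤ (+ 0) and fromℤ (+ 1) reduce to 0# and 1#, so the solver's
  -- constants :0 and :1 below denote exactly the ring's 0# and 1#.
  fromℤ : ℤ → Carrier
  fromℤ (+ n)    = n ×ᵣ 1#
  fromℤ -[1+ n ] = - (suc n ×ᵣ 1#)

  fromℤ-◃ : ∀ s n → fromℤ (s ◃ n) ≈ signed s (n ×ᵣ 1#)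
  fromℤ-◃ Sign.+ zero    = refl
  fromℤ-◃ Sign.- zero    = sym -0#≈0#
  fromℤ-◃ Sign.+ (suc n) = refl
  fromℤ-◃ Sign.- (suc n) = refl

  fromℤ-signAbs : ∀ i → fromℤ i ≈ signed (sign i) (∣ i ∣ ×ᵣ 1#)
  fromℤ-signAbs (+ n)    = refl
  fromℤ-signAbs -[1+ n ] = refl

  fromℤ-* : ∀ i j → fromℤ (i ℤ.* j) ≈ fromℤ i * fromℤ j
  fromℤ-* i j = begin
    fromℤ (sign i Sign.* sign j ◃ ∣ i ∣ ℕ.* ∣ j ∣)
      ≈⟨ fromℤ-◃ (sign i Sign.* sign j) (∣ i ∣ ℕ.* ∣ j ∣) ⟩
    signed (sign i Sign.* sign j) ((∣ i ∣ ℕ.* ∣ j ∣) ×ᵣ 1#)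
      ≈⟨ signed-cong (sign i Sign.* sign j) (×1-homo-* ∣ i ∣ ∣ j ∣) ⟩
    signed (sign i Sign.* sign j) ((∣ i ∣ ×ᵣ 1#) * (∣ j ∣ ×ᵣ 1#))
      ≈⟨ signed-* (sign i) (sign j) (∣ i ∣ ×ᵣ 1#) (∣ j ∣ ×ᵣ 1#) ⟩
    signed (sign i) (∣ i ∣ ×ᵣ 1#) * signed (sign j) (∣ j ∣ ×ᵣ 1#)
      ≈⟨ *-cong (fromℤ-signAbs i) (fromℤ-signAbs j) ⟨
    fromℤ i * fromℤ j ∎

  fromℤ-neg : ∀ i → fromℤ (ℤ.- i) ≈ - fromℤ i
  fromℤ-neg (+ zero)  = sym -0#≈0#
  fromℤ-neg (+ suc n) = refl
  fromℤ-neg -[1+ n ]  = sym (-‿involutive _)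

  +-cancelˡ-- : ∀ x a b → (x + a) - (x + b) ≈ a - b
  +-cancelˡ-- x a b = begin
    (x + a) - (x + b)    ≈⟨ +-congˡ (-‿+-comm x b) ⟨
    (x + a) + (- x - b)  ≈⟨ interchange x a (- x) (- b) ⟩
    (x - x) + (a - b)    ≈⟨ +-congʳ (-‿inverseʳ x) ⟩
    0# + (a - b)         ≈⟨ +-identityˡ (a - b) ⟩
    a - b                ∎

  fromℤ-⊖ : ∀ m n → fromℤ (m ⊖ n) ≈ m ×ᵣ 1# - n ×ᵣ 1#
  fromℤ-⊖ m       zero    = sym (trans (+-congˡ -0#≈0#) (+-identityʳ (m ×ᵣ 1#)))
  fromℤ-⊖ zero    (suc n) = sym (+-identityˡ _)
  fromℤ-⊖ (suc m) (suc n) = begin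
    fromℤ (suc m ⊖ suc n)          ≡⟨ ≡.cong fromℤ (ℤ.[1+m]⊖[1+n]≡m⊖n m n) ⟩
    fromℤ (m ⊖ n)                  ≈⟨ fromℤ-⊖ m n ⟩
    m ×ᵣ 1# - n ×ᵣ 1#                ≈⟨ +-cancelˡ-- 1# (m ×ᵣ 1#) (n ×ᵣ 1#) ⟨
    (1# + m ×ᵣ 1#) - (1# + n ×ᵣ 1#)  ≈⟨ +-cong (1+× m 1#) (-‿cong (1+× n 1#)) ⟨
    suc m ×ᵣ 1# - suc n ×ᵣ 1#        ∎

  fromℤ-+ : ∀ i j → fromℤ (i ℤ.+ j) ≈ fromℤ i + fromℤ j
  fromℤ-+ (+ m)    (+ n)    = ×-homo-+ 1# m n
  fromℤ-+ (+ m)    -[1+ n ] = fromℤ-⊖ m (suc n)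
  fromℤ-+ -[1+ m ] (+ n)    = trans (fromℤ-⊖ n (suc m)) (+-comm _ _)
  fromℤ-+ -[1+ m ] -[1+ n ] = begin
    - (suc (suc (m ℕ.+ n)) ×ᵣ 1#)    ≡⟨ ≡.cong (λ k → - (k ×ᵣ 1#)) (≡.sym (ℕ.+-suc (suc m) n)) ⟩
    - ((suc m ℕ.+ suc n) ×ᵣ 1#)      ≈⟨ -‿cong (×-homo-+ 1# (suc m) (suc n)) ⟩
    - (suc m ×ᵣ 1# + suc n ×ᵣ 1#)     ≈⟨ -‿+-comm _ _ ⟨
    - (suc m ×ᵣ 1#) - suc n ×ᵣ 1#     ∎

  fromℤ-homomorphism : ℤ.+-*-rawRing ACR.-Raw-AlmostCommutative⟶ ACR.fromCommutativeRing R
  fromℤ-homomorphism = record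
    { ⟦_⟧ = fromℤ ; +-homo = fromℤ-+ ; *-homo = fromℤ-* ; -‿homo = fromℤ-neg
    ; 0-homo = refl ; 1-homo = refl }

  fromℤ-≈? : ∀ i j → Maybe (fromℤ i ≈ fromℤ j)
  fromℤ-≈? i j with i ℤ.≟ j
  ... | yes ≡.refl = just refl
  ... | no _       = nothing

  open import Algebra.Solver.Ring ℤ.+-*-rawRing (ACR.fromCommutativeRing R) fromℤ-homomorphism fromℤ-≈?
    public using (Polynomial; con; solve; _:=_; _:+_; _:-_; _:*_; :-_)

  :0 :1 : ∀ {n} → Polynomial n
  :0 = con (+ 0)
  :1 = con (+ 1)

module IdealLemmas {c ℓ : Level} (R : CommutativeRing c ℓ) where
  open CommutativeRing R
  open CommutativeSemigroupProperties +-commutativeSemigroup using (interchange)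
  open GroupProperties +-group using (x∙y⁻¹≈ε⇒x≈y)
  open IntegerCoefficientSolver R
  open SetoidReasoning setoid

  Σᶠ-closed : ∀ {K} → IsIdeal R K → ∀ n (f : Fin n → Carrier) → (∀ i → K (f i)) → K (Σᶠ R n f)
  Σᶠ-closed KI zero    f f∈K = IsIdeal.zero∈ KI
  Σᶠ-closed KI (suc n) f f∈K =
    IsIdeal.+-closed KI (f∈K fzero) (Σᶠ-closed KI n (λ i → f (fsuc i)) (λ i → f∈K (fsuc i)))

  ·-⊆ : ∀ {A B K} → IsIdeal R K → (∀ {a b} → A a → B b → K (a * b)) → _⊆_ R (_·_ R A B) K
  ·-⊆ KI ab∈K x (n , a , b , (a∈A , b∈B) , x≈Σ) =
    IsIdeal.resp KI (sym x≈Σ) (Σᶠ-closed KI n _ (λ i → ab∈K (a∈A i) (b∈B i)))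

  ·-⊆ˡ : ∀ {A B K} → IsIdeal R K → _⊆_ R A K → _⊆_ R (_·_ R A B) K
  ·-⊆ˡ {A} {B} KI A⊆K = ·-⊆ {A} {B} KI λ {a} {b} a∈A _ →
    IsIdeal.resp KI (*-comm b a) (IsIdeal.*-closed KI b (A⊆K a a∈A))

  ·-⊆ʳ : ∀ {A B K} → IsIdeal R K → _⊆_ R B K → _⊆_ R (_·_ R A B) K
  ·-⊆ʳ {A} {B} KI B⊆K = ·-⊆ {A} {B} KI (λ {a} {b} _ b∈B → IsIdeal.*-closed KI a (B⊆K b b∈B))

  ·-∋ : ∀ {A B a b x} → A a → B b → x ≈ a * b → _·_ R A B x
  ·-∋ {a = a} {b} a∈A b∈B x≈ab =
    1 , (λ _ → a) , (λ _ → b) , ((λ _ → a∈A) , (λ _ → b∈B)) , trans x≈ab (sym (+-identityʳ (a * b)))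

  ·-∋₂ : ∀ {A B a₁ b₁ a₂ b₂ x} → A a₁ → B b₁ → A a₂ → B b₂ → x ≈ a₁ * b₁ + a₂ * b₂ → _·_ R A B x
  ·-∋₂ {A} {B} {a₁} {b₁} {a₂} {b₂} a₁∈A b₁∈B a₂∈A b₂∈B x≈ =
    2 , a , b , (a∈A , b∈B) , trans x≈ (+-congˡ (sym (+-identityʳ (a₂ * b₂))))
    where
    a b : Fin 2 → Carrier
    a fzero    = a₁
    a (fsuc _) = a₂
    b fzero    = b₁
    b (fsuc _) = b₂
    a∈A : ∀ i → A (a i)
    a∈A fzero    = a₁∈A
    a∈A (fsuc _) = a₂∈A
    b∈B : ∀ i → B (b i)
    b∈B fzero    = b₁∈B
    b∈B (fsuc _) = b₂∈B

  ⊆-^ᴵ1 : ∀ {A} → _⊆_ R A (_^ᴵ_ R A 1)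
  ⊆-^ᴵ1 x x∈A = ·-∋ x∈A (lift _) (sym (*-identityʳ x))

  ⟨⟩-isIdeal : ∀ p → IsIdeal R (⟨_⟩ R p)
  ⟨⟩-isIdeal p = record
    { resp     = λ { x≈y (r , x≈rp) → r , trans (sym x≈y) x≈rp }
    ; zero∈    = 0# , sym (zeroˡ p)
    ; +-closed = λ { (r , x≈rp) (s , y≈sp) → r + s , trans (+-cong x≈rp y≈sp) (sym (distribʳ p r s)) }
    ; *-closed = λ { t (r , x≈rp) → t * r , trans (*-congˡ x≈rp) (sym (*-assoc t r p)) }
    }

  ⟨⟩-∋ : ∀ r p → ⟨_⟩ R p (r * p)
  ⟨⟩-∋ r p = r , refl

  ⟨⟩-∋generator : ∀ p → ⟨_⟩ R p p
  ⟨⟩-∋generator p = 1# , sym (*-identityˡ p)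

  ⟨⟩-* : ∀ {a b x y} → ⟨_⟩ R a x → ⟨_⟩ R b y → ⟨_⟩ R (a * b) (x * y)
  ⟨⟩-* {a} {b} {x} {y} (r , x≈ra) (s , y≈sb) = r * s , (begin
    x * y              ≈⟨ *-cong x≈ra y≈sb ⟩
    (r * a) * (s * b)  ≈⟨ solve 4 (λ r a s b → r :* a :* (s :* b) := r :* s :* (a :* b)) refl r a s b ⟩
    (r * s) * (a * b)  ∎)

  ⟨⟩^ᴵ⊆⟨pow⟩ : ∀ p n → _⊆_ R (_^ᴵ_ R (⟨_⟩ R p) n) (⟨_⟩ R (pow R p n))
  ⟨⟩^ᴵ⊆⟨pow⟩ p zero    x _ = x , sym (*-identityʳ x)
  ⟨⟩^ᴵ⊆⟨pow⟩ p (suc n) = ·-⊆ (⟨⟩-isIdeal _) (λ {a} {b} a∈P b∈Pⁿ → ⟨⟩-* a∈P (⟨⟩^ᴵ⊆⟨pow⟩ p n b b∈Pⁿ))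

  ⟨⟩^ᴵ⊆⟨⟩ : ∀ p {n} → 0 < n → _⊆_ R (_^ᴵ_ R (⟨_⟩ R p) n) (⟨_⟩ R p)
  ⟨⟩^ᴵ⊆⟨⟩ p {suc n} _ = ·-⊆ˡ {⟨_⟩ R p} {_^ᴵ_ R (⟨_⟩ R p) n} (⟨⟩-isIdeal p) (λ _ x∈P → x∈P)

  pow∈⟨⟩^ᴵ : ∀ p n → _^ᴵ_ R (⟨_⟩ R p) n (pow R p n)
  pow∈⟨⟩^ᴵ p zero    = lift _
  pow∈⟨⟩^ᴵ p (suc n) =
    ·-∋ {⟨_⟩ R p} {_^ᴵ_ R (⟨_⟩ R p) n} (⟨⟩-∋ 1# p) (pow∈⟨⟩^ᴵ p n) (*-congʳ (sym (*-identityˡ p)))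

  _+ᴵ_ : Sub R → Sub R → Sub R
  (A +ᴵ B) x = Σ Carrier λ a → Σ Carrier λ b → A a × B b × x ≈ a + b

  +ᴵ-isIdeal : ∀ {A B} → IsIdeal R A → IsIdeal R B → IsIdeal R (A +ᴵ B)
  +ᴵ-isIdeal AI BI = record
    { resp     = λ { x≈y (a , b , a∈A , b∈B , x≈a+b) → a , b , a∈A , b∈B , trans (sym x≈y) x≈a+b }
    ; zero∈    = 0# , 0# , IsIdeal.zero∈ AI , IsIdeal.zero∈ BI , sym (+-identityʳ 0#)
    ; +-closed = λ { (a , b , a∈A , b∈B , x≈a+b) (a′ , b′ , a′∈A , b′∈B , y≈a′+b′) →
        a + a′ , b + b′ , IsIdeal.+-closed AI a∈A a′∈A , IsIdeal.+-closed BI b∈B b′∈B ,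
        trans (+-cong x≈a+b y≈a′+b′) (interchange a b a′ b′) }
    ; *-closed = λ { t (a , b , a∈A , b∈B , x≈a+b) →
        t * a , t * b , IsIdeal.*-closed AI t a∈A , IsIdeal.*-closed BI t b∈B ,
        trans (*-congˡ x≈a+b) (distribˡ t a b) }
    }

  ⊆-+ᴵˡ : ∀ {A B} → IsIdeal R B → _⊆_ R A (A +ᴵ B)
  ⊆-+ᴵˡ BI x x∈A = x , 0# , x∈A , IsIdeal.zero∈ BI , sym (+-identityʳ x)

  ⊆-+ᴵʳ : ∀ {A B} → IsIdeal R A → _⊆_ R B (A +ᴵ B)
  ⊆-+ᴵʳ AI x x∈B = 0# , x , IsIdeal.zero∈ AI , x∈B , sym (+-identityˡ x)

  maximal-comaximal : ∀ {M J} → IsMaximalIdeal R M → IsIdeal R J → ¬ _⊆_ R J M → (M +ᴵ J) 1#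
  maximal-comaximal {M} {J} M-max JI J⊈M =
    fromInj₂ (λ M+J⊆M → ⊥-elim (J⊈M (λ x x∈J → M+J⊆M x (⊆-+ᴵʳ MI x x∈J))))
      (maximal (M +ᴵ J) (+ᴵ-isIdeal MI JI) (⊆-+ᴵˡ JI))
    where open IsMaximalIdeal M-max renaming (isIdeal to MI)

  principal-comaximal : ∀ {p J} → IsIdeal R J → (⟨_⟩ R p +ᴵ J) 1# → Σ Carrier λ r → J (1# - r * p)
  principal-comaximal {p} JI (a , b , (r , a≈rp) , b∈J , 1≈a+b) = r , IsIdeal.resp JI b≈1-rp b∈J
    where
    b≈1-rp : b ≈ 1# - r * p
    b≈1-rp = begin
      b              ≈⟨ solve 2 (λ a b → b := (a :+ b) :- a) refl a b ⟩
      (a + b) - a    ≈⟨ +-cong (sym 1≈a+b) (-‿cong a≈rp) ⟩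
      1# - r * p     ∎

  IsUnitMod-mono : ∀ {A B x} → _⊆_ R A B → IsUnitMod R A x → IsUnitMod R B x
  IsUnitMod-mono A⊆B (s , xs-1∈A) = s , A⊆B _ xs-1∈A

  -- Chinese remainder theorem for units: u ≡ 0 mod A and u ≡ 1 mod B glue the two inverses.
  IsUnitMod-· : ∀ {A B u x} → A u → B (1# - u) → IsUnitMod R A x → IsUnitMod R B x →
                IsUnitMod R (_·_ R A B) x
  IsUnitMod-· {A} {B} {u} {x} u∈A 1-u∈B (s , xs-1∈A) (s′ , xs′-1∈B) =
    s * (1# - u) + s′ * u , ·-∋₂ {A} {B} xs-1∈A 1-u∈B u∈A xs′-1∈B (gluing x s s′ u)
    where
    gluing : ∀ x s s′ u →
             x * (s * (1# - u) + s′ * u) - 1# ≈ (x * s - 1#) * (1# - u) + u * (x * s′ - 1#)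
    gluing = solve 4 (λ x s s′ u →
      x :* (s :* (:1 :- u) :+ s′ :* u) :- :1 := (x :* s :- :1) :* (:1 :- u) :+ u :* (x :* s′ :- :1)) refl

  IsUnitMod-by : ∀ {K g} → IsIdeal R K → K g → ∀ {x} s m → x * s - 1# ≈ m * g → IsUnitMod R K x
  IsUnitMod-by KI g∈K s m xs-1≈mg = s , IsIdeal.resp KI (sym xs-1≈mg) (IsIdeal.*-closed KI m g∈K)

  Distinct-by : ∀ {I K g z} → IsIdeal R K → _⊆_ R I K → K g → ¬ K z →
                ∀ {x y} a b → z ≈ a * (x - y) + b * g → Distinct R I x y
  Distinct-by KI I⊆K g∈K z∉K a b z≈ x-y∈I =
    z∉K (IsIdeal.resp KI (sym z≈)
      (IsIdeal.+-closed KI (IsIdeal.*-closed KI a (I⊆K _ x-y∈I)) (IsIdeal.*-closed KI b g∈K)))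

  generator≉0 : ∀ {K p} → IsNonzero R K → _⊆_ R K (⟨_⟩ R p) → ¬ p ≈ 0#
  generator≉0 {p = p} (x , x∈K , x≉0) K⊆⟨p⟩ p≈0 with K⊆⟨p⟩ x x∈K
  ... | r , x≈rp = x≉0 (trans x≈rp (trans (*-congˡ p≈0) (zeroʳ r)))

  NoZeroDivisors : Set (c Level.⊔ ℓ)
  NoZeroDivisors = ∀ a b → a * b ≈ 0# → a ≈ 0# ⊎ b ≈ 0#

  pow≉0 : ¬ 1# ≈ 0# → NoZeroDivisors → ∀ {p} → ¬ p ≈ 0# → ∀ n → ¬ pow R p n ≈ 0#
  pow≉0 1≉0 nzd p≉0 zero    = 1≉0
  pow≉0 1≉0 nzd p≉0 (suc n) pⁿ⁺¹≈0 with nzd _ _ pⁿ⁺¹≈0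
  ... | inj₁ p≈0  = p≉0 p≈0
  ... | inj₂ pⁿ≈0 = pow≉0 1≉0 nzd p≉0 n pⁿ≈0

  ⟨⟩-cancel : NoZeroDivisors → ∀ {a b x} → ¬ a ≈ 0# → ⟨_⟩ R (b * a) (a * x) → ⟨_⟩ R b x
  ⟨⟩-cancel nzd {a} {b} {x} a≉0 (s , ax≈s[ba]) with nzd a (x - s * b) a[x-sb]≈0
    where
    a[x-sb]≈0 : a * (x - s * b) ≈ 0#
    a[x-sb]≈0 = begin
      a * (x - s * b)
        ≈⟨ solve 4 (λ a b s x → a :* (x :- s :* b) := a :* x :- s :* (b :* a)) refl a b s x ⟩
      a * x - s * (b * a)        ≈⟨ +-congʳ ax≈s[ba] ⟩
      s * (b * a) - s * (b * a)  ≈⟨ -‿inverseʳ _ ⟩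
      0#                         ∎
  ... | inj₁ a≈0      = ⊥-elim (a≉0 a≈0)
  ... | inj₂ x-sb≈0   = s , x∙y⁻¹≈ε⇒x≈y x (s * b) x-sb≈0

module FourCycles {c ℓ : Level} (R : CommutativeRing c ℓ) where
  open CommutativeRing R
  open IntegerCoefficientSolver R
  open IdealLemmas R

  has4Cycle-⟨p⟩·J : ∀ p r {J} → IsIdeal R J → ¬ ⟨_⟩ R p 1# → J (1# - r * p) →
                    ¬ J (p - 1#) → ¬ J (p + 1#) → Has4Cycle R (_·_ R (_^ᴵ_ R (⟨_⟩ R p) 1) J)
  has4Cycle-⟨p⟩·J p r {J} JI 1∉P j∈J p-1∉J p+1∉J =
    0# , 1# , c′ , d′ , (D01 , D0c , D0d , D1c , D1d , Dcd) , (A01 , A1c , Acd , Ad0)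
    where
    P I : Sub R
    P = ⟨_⟩ R p
    I = _·_ R (_^ᴵ_ R P 1) J

    PI : IsIdeal R P
    PI = ⟨⟩-isIdeal p

    p∈P : P p
    p∈P = ⟨⟩-∋generator p

    j c′ d′ : Carrier
    j = 1# - r * p
    c′ = r * p - p
    d′ = j - p

    I⊆P : _⊆_ R I P
    I⊆P = ·-⊆ˡ {_^ᴵ_ R P 1} {J} PI (⟨⟩^ᴵ⊆⟨⟩ p {1} (s≤s ℕ.z≤n))

    I⊆J : _⊆_ R I J
    I⊆J = ·-⊆ʳ {_^ᴵ_ R P 1} {J} JI (λ _ x∈J → x∈J)

    unit : ∀ {x} → IsUnitMod R P x → IsUnitMod R J x → IsUnitMod R I x
    unit x⁻¹modP x⁻¹modJ =
      IsUnitMod-· {_^ᴵ_ R P 1} {J} (⊆-^ᴵ1 {P} _ (⟨⟩-∋ r p)) j∈J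
        (IsUnitMod-mono {P} (⊆-^ᴵ1 {P}) x⁻¹modP) x⁻¹modJ

    A01 : Adj R I 0# 1#
    A01 = unit
      (IsUnitMod-by PI p∈P (- 1#) 0#
        (solve 1 (λ p → (:0 :- :1) :* (:- :1) :- :1 := :0 :* p) refl p))
      (IsUnitMod-by JI j∈J (- 1#) 0#
        (solve 2 (λ p r → (:0 :- :1) :* (:- :1) :- :1 := :0 :* (:1 :- r :* p)) refl p r))

    A1c : Adj R I 1# c′
    A1c = unit
      (IsUnitMod-by PI p∈P 1# (1# - r)
        (solve 2 (λ p r → (:1 :- (r :* p :- p)) :* :1 :- :1 := (:1 :- r) :* p) refl p r))
      (IsUnitMod-by JI j∈J r (r - 1#)
        (solve 2 (λ p r → (:1 :- (r :* p :- p)) :* r :- :1 := (r :- :1) :* (:1 :- r :* p)) refl p r))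

    Acd : Adj R I c′ d′
    Acd = unit
      (IsUnitMod-by PI p∈P (- 1#) (- (r + r))
        (solve 2 (λ p r → let j = :1 :- r :* p in
          (r :* p :- p :- (j :- p)) :* (:- :1) :- :1 := (:- (r :+ r)) :* p) refl p r))
      (IsUnitMod-by JI j∈J 1# (- 1# - 1#)
        (solve 2 (λ p r → let j = :1 :- r :* p in
          (r :* p :- p :- (j :- p)) :* :1 :- :1 := (:- :1 :- :1) :* j) refl p r))

    Ad0 : Adj R I d′ 0#
    Ad0 = unit
      (IsUnitMod-by PI p∈P 1# (- r - 1#)
        (solve 2 (λ p r → let j = :1 :- r :* p in
          (j :- p :- :0) :* :1 :- :1 := (:- r :- :1) :* p) refl p r))
      (IsUnitMod-by JI j∈J (- r) (- r - 1#)
        (solve 2 (λ p r → let j = :1 :- r :* p in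
          (j :- p :- :0) :* (:- r) :- :1 := (:- r :- :1) :* j) refl p r))

    D01 : Distinct R I 0# 1#
    D01 = Distinct-by PI I⊆P p∈P 1∉P (- 1#) 0#
      (solve 1 (λ p → :1 := (:- :1) :* (:0 :- :1) :+ :0 :* p) refl p)

    D0c : Distinct R I 0# c′
    D0c = Distinct-by JI I⊆J j∈J p-1∉J 1# (- 1#)
      (solve 2 (λ p r → p :- :1 := :1 :* (:0 :- (r :* p :- p)) :+ (:- :1) :* (:1 :- r :* p)) refl p r)

    D0d : Distinct R I 0# d′
    D0d = Distinct-by PI I⊆P p∈P 1∉P (- 1#) (r + 1#)
      (solve 2 (λ p r → :1 := (:- :1) :* (:0 :- (:1 :- r :* p :- p)) :+ (r :+ :1) :* p) refl p r)

    D1c : Distinct R I 1# c′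
    D1c = Distinct-by PI I⊆P p∈P 1∉P 1# (r - 1#)
      (solve 2 (λ p r → :1 := :1 :* (:1 :- (r :* p :- p)) :+ (r :- :1) :* p) refl p r)

    D1d : Distinct R I 1# d′
    D1d = Distinct-by JI I⊆J j∈J p+1∉J 1# 1#
      (solve 2 (λ p r → let j = :1 :- r :* p in
        p :+ :1 := :1 :* (:1 :- (j :- p)) :+ :1 :* j) refl p r)

    Dcd : Distinct R I c′ d′
    Dcd = Distinct-by PI I⊆P p∈P 1∉P (- 1#) (r + r)
      (solve 2 (λ p r → let j = :1 :- r :* p in
        :1 := (:- :1) :* (r :* p :- p :- (j :- p)) :+ (r :+ r) :* p) refl p r)

  has4Cycle-⟨p⟩²⁺ᵏ·J : NoZeroDivisors → ∀ p r k {J} → IsIdeal R J → ¬ ⟨_⟩ R p 1# →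
                       ¬ pow R p (suc k) ≈ 0# → J (1# - r * p) →
                       Has4Cycle R (_·_ R (_^ᴵ_ R (⟨_⟩ R p) (suc (suc k))) J)
  has4Cycle-⟨p⟩²⁺ᵏ·J nzd p r k {J} JI 1∉P pᵏ⁺¹≉0 j∈J =
    0# , 1# , t , 1# + t ,
    (D01 , D0t , D0[1+t] , D1t , D1[1+t] , Dt[1+t]) , (A01 , A1t , At[1+t] , A[1+t]0)
    where
    P Pᵅ I : Sub R
    P = ⟨_⟩ R p
    Pᵅ = _^ᴵ_ R P (suc (suc k))
    I = _·_ R Pᵅ J

    PI : IsIdeal R P
    PI = ⟨⟩-isIdeal p

    p∈P : P p
    p∈P = ⟨⟩-∋generator p

    q j t : Carrier
    q = pow R p k
    j = 1# - r * p
    t = p * q * j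

    I⊆⟨pᵅ⟩ : _⊆_ R I (⟨_⟩ R (p * (p * q)))
    I⊆⟨pᵅ⟩ = ·-⊆ˡ {Pᵅ} {J} (⟨⟩-isIdeal _) (⟨⟩^ᴵ⊆⟨pow⟩ p (suc (suc k)))

    I⊆P : _⊆_ R I P
    I⊆P = ·-⊆ˡ {Pᵅ} {J} PI (⟨⟩^ᴵ⊆⟨⟩ p {suc (suc k)} (s≤s ℕ.z≤n))

    j∉P : ¬ P j
    j∉P j∈P = 1∉P (IsIdeal.resp PI (solve 2 (λ p r → :1 :- r :* p :+ r :* p := :1) refl p r)
                                   (IsIdeal.+-closed PI j∈P (⟨⟩-∋ r p)))

    t∉⟨pᵅ⟩ : ¬ ⟨_⟩ R (p * (p * q)) t
    t∉⟨pᵅ⟩ t∈⟨pᵅ⟩ = j∉P (⟨⟩-cancel nzd pᵏ⁺¹≉0 t∈⟨pᵅ⟩)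

    unit : ∀ {x} s m → x * s - 1# ≈ p * (p * q) * (m * j) → IsUnitMod R I x
    unit s m x⁻¹ = s , ·-∋ {Pᵅ} {J} (pow∈⟨⟩^ᴵ p (suc (suc k))) (IsIdeal.*-closed JI m j∈J) x⁻¹

    A01 : Adj R I 0# 1#
    A01 = unit (- 1#) 0#
      (solve 3 (λ p q r → let j = :1 :- r :* p in
        (:0 :- :1) :* (:- :1) :- :1 := p :* (p :* q) :* (:0 :* j)) refl p q r)

    A1t : Adj R I 1# t
    A1t = unit (1# + t) (- (q * j))
      (solve 3 (λ p q r → let j = :1 :- r :* p ; t = p :* q :* j in
        (:1 :- t) :* (:1 :+ t) :- :1 := p :* (p :* q) :* ((:- (q :* j)) :* j)) refl p q r)

    At[1+t] : Adj R I t (1# + t)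
    At[1+t] = unit (- 1#) 0#
      (solve 3 (λ p q r → let j = :1 :- r :* p ; t = p :* q :* j in
        (t :- (:1 :+ t)) :* (:- :1) :- :1 := p :* (p :* q) :* (:0 :* j)) refl p q r)

    A[1+t]0 : Adj R I (1# + t) 0#
    A[1+t]0 = unit (1# - t) (- (q * j))
      (solve 3 (λ p q r → let j = :1 :- r :* p ; t = p :* q :* j in
        (:1 :+ t :- :0) :* (:1 :- t) :- :1 := p :* (p :* q) :* ((:- (q :* j)) :* j)) refl p q r)

    D01 : Distinct R I 0# 1#
    D01 = Distinct-by PI I⊆P p∈P 1∉P (- 1#) 0#
      (solve 1 (λ p → :1 := (:- :1) :* (:0 :- :1) :+ :0 :* p) refl p)

    D0t : Distinct R I 0# t
    D0t = Distinct-by (⟨⟩-isIdeal _) I⊆⟨pᵅ⟩ (⟨⟩-∋generator _) t∉⟨pᵅ⟩ (- 1#) 0#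
      (solve 2 (λ t g → t := (:- :1) :* (:0 :- t) :+ :0 :* g) refl t (p * (p * q)))

    D0[1+t] : Distinct R I 0# (1# + t)
    D0[1+t] = Distinct-by PI I⊆P p∈P 1∉P (- 1#) (- (q * j))
      (solve 3 (λ p q r → let j = :1 :- r :* p ; t = p :* q :* j in
        :1 := (:- :1) :* (:0 :- (:1 :+ t)) :+ (:- (q :* j)) :* p) refl p q r)

    D1t : Distinct R I 1# t
    D1t = Distinct-by PI I⊆P p∈P 1∉P 1# (q * j)
      (solve 3 (λ p q r → let j = :1 :- r :* p ; t = p :* q :* j in
        :1 := :1 :* (:1 :- t) :+ (q :* j) :* p) refl p q r)

    D1[1+t] : Distinct R I 1# (1# + t)
    D1[1+t] = Distinct-by (⟨⟩-isIdeal _) I⊆⟨pᵅ⟩ (⟨⟩-∋generator _) t∉⟨pᵅ⟩ (- 1#) 0#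
      (solve 2 (λ t g → t := (:- :1) :* (:1 :- (:1 :+ t)) :+ :0 :* g) refl t (p * (p * q)))

    Dt[1+t] : Distinct R I t (1# + t)
    Dt[1+t] = Distinct-by PI I⊆P p∈P 1∉P (- 1#) 0#
      (solve 2 (λ t p → :1 := (:- :1) :* (t :- (:1 :+ t)) :+ :0 :* p) refl t p)

theorem4p6 : {c ℓ : Level} (R : CommutativeRing c ℓ) → IsDedekindDomain R →
    (p : CommutativeRing.Carrier R) → IsPrimeIdeal R (⟨_⟩ R p) →
    (J : Sub R) → IsIdeal R J → ¬ (_⊆_ R J (⟨_⟩ R p)) →
    (α : ℕ) → 0 < α →
    IsNonzero R (_·_ R (_^ᴵ_ R (⟨_⟩ R p) α) J) →
    FiniteQuotient R (_·_ R (_^ᴵ_ R (⟨_⟩ R p) α) J) →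
    (1 < α ⊎ (¬ J (CommutativeRing._-_ R p (CommutativeRing.1# R)) × ¬ J (CommutativeRing._+_ R p (CommutativeRing.1# R)))) →
    Has4Cycle R (_·_ R (_^ᴵ_ R (⟨_⟩ R p) α) J)
theorem4p6 R R-dedekind p P-prime J JI J⊈P α 0<α I≢0 _ = cycle α 0<α
  where
  open CommutativeRing R
  open IdealLemmas R
  open FourCycles R
  open IsDedekindDomain R-dedekind using (1≉0; noZeroDivisors; dimension≤1)

  p≉0 : ¬ p ≈ 0#
  p≉0 = generator≉0 I≢0 (·-⊆ˡ {_^ᴵ_ R (⟨_⟩ R p) α} {J} (⟨⟩-isIdeal p) (⟨⟩^ᴵ⊆⟨⟩ p 0<α))

  P-maximal : IsMaximalIdeal R (⟨_⟩ R p)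
  P-maximal = dimension≤1 _ P-prime (p , ⟨⟩-∋generator p , p≉0)

  comaximal : Σ Carrier λ r → J (1# - r * p)
  comaximal = principal-comaximal JI (maximal-comaximal P-maximal JI J⊈P)
  open Σ comaximal renaming (proj₁ to r; proj₂ to 1-rp∈J)

  cycle : ∀ α → 0 < α → 1 < α ⊎ (¬ J (p - 1#) × ¬ J (p + 1#)) →
          Has4Cycle R (_·_ R (_^ᴵ_ R (⟨_⟩ R p) α) J)
  cycle (suc zero)    _ (inj₁ (s≤s ()))
  cycle (suc zero)    _ (inj₂ (p-1∉J , p+1∉J)) =
    has4Cycle-⟨p⟩·J p r JI (IsPrimeIdeal.proper P-prime) 1-rp∈J p-1∉J p+1∉J
  cycle (suc (suc k)) _ _ =
    has4Cycle-⟨p⟩²⁺ᵏ·J noZeroDivisors p r k JI (IsPrimeIdeal.proper P-prime)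
      (pow≉0 1≉0 noZeroDivisors p≉0 (suc k)) 1-rp∈J
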